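{- In the graph system $ALFAo$, the rule $R_1$ is derivable: for every graph $A$, $A \vdash_{ALFAo} AA$.
   Context: Graphs of $ALFAo$: the empty graph $\emptyset$ (blank sheet) and each propositional letter are graphs; if $G,H$ are graphs then their juxtaposition $GH$ is a graph, and the cut $[G]$ ($G$ enclosed in a solid closed curve) is a graph. Juxtaposition is associative and commutative with unit $\emptyset$ (graphs drawn on the plane are unordered); $[\,]$ denotes the empty cut. Rules are schemata in which $A,B,C$ range over arbitrary (possibly empty) graphs and are applied to the whole graph on the sheet. First-degree rules: $R_2: AB\vdash A$; $R_3: [A]\vdash[AB]$; $R_4: [BC[A]]\vdash[BC[AB]]$; $R_5: A[AB]\vdash A[B]$; $R_6: A[[B]]\vdash AB$; $R_7: [AB]\vdash[A[[B]]]$. Second-degree rules: $R_8$: if $AB\vdash C$ then $A\vdash[B[C]]$; $R_0$: if $A\vdash B$ and $A\vdash C$ then $A\vdash BC$. The derivability relation $\vdash_{ALFAo}$ is the least binary relation on graphs that contains all instances of the first-degree rules, is transitive, and is closed under the second-degree rules (whenever the premises are derivable, so is the conclusion). -}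

module Defs where

open import Data.Nat using (ℕ)

-- Graphs of ALFAo: empty graph, propositional letters (indexed by ℕ),
-- juxtaposition, and cut.
data Graph : Set where
  ∅    : Graph
  var  : ℕ → Graph
  _·_  : Graph → Graph → Graph
  [_]  : Graph → Graph

infixl 6 _·_

-- Identity of graphs: juxtaposition is associative and commutative with
-- unit ∅ (graphs drawn on the plane are unordered); a congruence.
data _≈_ : Graph → Graph → Set where
  ≈-refl  : ∀ {A} → A ≈ A
  ≈-sym   : ∀ {A B} → A ≈ B → B ≈ A
  ≈-trans : ∀ {A B C} → A ≈ B → B ≈ C → A ≈ C
  ≈-assoc : ∀ {A B C} → (A · B) · C ≈ A · (B · C)
  ≈-comm  : ∀ {A B} → A · B ≈ B · A
  ≈-unit  : ∀ {A} → A · ∅ ≈ A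
  ≈-juxt  : ∀ {A A′ B B′} → A ≈ A′ → B ≈ B′ → A · B ≈ A′ · B′
  ≈-cut   : ∀ {A A′} → A ≈ A′ → [ A ] ≈ [ A′ ]

infix 4 _≈_ _⊢_

-- Since graphs are taken up to ≈ (the same drawn graph), ≈-related graphs
-- are interderivable (constructor conv).
data _⊢_ : Graph → Graph → Set where
  conv : ∀ {A B} → A ≈ B → A ⊢ B
  R2 : ∀ {A B} → A · B ⊢ A
  R3 : ∀ {A B} → [ A ] ⊢ [ A · B ]
  R4 : ∀ {A B C} → [ B · C · [ A ] ] ⊢ [ B · C · [ A · B ] ]
  R5 : ∀ {A B} → A · [ A · B ] ⊢ A · [ B ]
  R6 : ∀ {A B} → A · [ [ B ] ] ⊢ A · B
  R7 : ∀ {A B} → [ A · B ] ⊢ [ A · [ [ B ] ] ]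
  trans : ∀ {A B C} → A ⊢ B → B ⊢ C → A ⊢ C
  R8 : ∀ {A B C} → A · B ⊢ C → A ⊢ [ B · [ C ] ]
  R0 : ∀ {A B C} → A ⊢ B → A ⊢ C → A ⊢ B · C

module Submission where

open import Defs

⊢-refl : ∀ {A} → A ⊢ A
⊢-refl = conv ≈-refl

mainTheorem1 : (A : Graph) → A ⊢ A · A
mainTheorem1 A = R0 ⊢-refl ⊢-refl
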